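{- Let $\xi$ be an address and $n\in\mathbb N$. For every design $\mathfrak E\in\mathbb L_n$ there exists a path $\mathfrak p$ of $\mathfrak E$ in which every action of $\mathfrak E$ (i.e. every action occurring in some chronicle of $\mathfrak E$) occurs.
   Context: Ludics: actions are $(+,\xi,I)$, $(-,\xi,I)$ (address a finite sequence of naturals, $I$ finite set of naturals) or the positive daimon $\maltese$; an action on $\xi.i$ is justified by an action of opposite polarity on $\xi$ whose ramification contains $i$; an action is initial if its address is in the base. Chronicles: nonempty finite alternating sequences on a base, each proper action initial or justified by an earlier one, non-initial negative actions justified by the immediately preceding action, distinct addresses, $\maltese$ only last. View: $\ulcorner\epsilon\urcorner=\epsilon$, $\ulcorner\kappa\urcorner=\kappa$, $\ulcorner w\kappa^+\urcorner=\ulcorner w\urcorner\kappa^+$, $\ulcorner w\kappa^-\urcorner=\ulcorner w_0\urcorner\kappa^-$ with $w_0$ empty if $\kappa^-$ initial, else the prefix of $w$ ending with the justifier of $\kappa^-$. A path is a finite alternating sequence of actions on a base, each proper action initial or justified by an earlier one, each justified positive action having its justifier in the view of the preceding prefix, distinct addresses, $\maltese$ only last, nonempty starting positively for a positive base; it is a path of a design $\mathfrak D$ if the views of all nonempty prefixes are chronicles of $\mathfrak D$. Lists: $\mathbf 0_\tau=\{(+,\tau,\emptyset)\}$, $(\mathbf{k+1})_\tau$ the prefix closure of $\{(+,\tau,\{0\})(-,\tau.0,\{1\})\mathfrak c\mid\mathfrak c\in\mathbf k_{\tau.0.1}\}$; $\mathfrak D^{\epsilon}_\xi=\{(+,\xi,\emptyset)\}$,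 and for $n>0$, $\mathfrak D^{\langle a_1,\dots,a_n\rangle}_\xi$ is the prefix closure of $\{(+,\xi,\{0,1\})(-,\xi.0,\{1\})\mathfrak c\mid\mathfrak c\in(\mathbf a_1)_{\xi.0.1}\}\cup\{(+,\xi,\{0,1\})(-,\xi.1,\{1\})\mathfrak c\mid\mathfrak c\in\mathfrak D^{\langle a_2,\dots,a_n\rangle}_{\xi.1.1}\}$; $\mathbb L_n=\{\mathfrak D^{\langle a_1,\dots,a_n\rangle}_\xi\mid a_i\in\mathbb N\}$. -}

module Defs where

open import Data.Nat using (ℕ; zero; suc) renaming (_≡ᵇ_ to _==ℕ_)
open import Data.Bool using (Bool; true; false; _∧_; _∨_; not; T; if_then_else_)
open import Data.List using (List; []; _∷_; _++_; _∷ʳ_; [_]; reverse; mapMaybe)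
open import Data.List.Membership.Propositional using (_∈_)
open import Data.List.Relation.Unary.Unique.Propositional using (Unique)
open import Data.Maybe using (Maybe; just; nothing)
open import Data.Vec using (Vec) renaming ([] to []ᵥ; _∷_ to _∷ᵥ_)
open import Data.Product using (Σ; ∃; _×_; _,_)
open import Data.Sum using (_⊎_)
open import Data.Empty using (⊥)
open import Data.Unit using (⊤)
open import Relation.Nullary using (¬_)
open import Relation.Binary.PropositionalEquality using (_≡_; _≢_)

-- An address is a finite sequence of naturals; ξ.i is ξ ∷ʳ i.
Address : Set
Address = List ℕ

-- A ramification (finite set of naturals) is represented by a list.
Ramification : Set
Ramification = List ℕ

data Pol : Set where
  pos neg : Pol

data Action : Set where
  act    : Pol → Address → Ramification → Action
  daimon : Action

polarity : Action → Pol
polarity (act π _ _) = π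
polarity daimon      = pos

address : Action → Maybe Address
address (act _ α _) = just α
address daimon      = nothing

Proper : Action → Set
Proper (act _ _ _) = ⊤
Proper daimon      = ⊥

eqPol : Pol → Pol → Bool
eqPol pos pos = true
eqPol neg neg = true
eqPol _   _   = false

eqAddr : Address → Address → Bool
eqAddr []       []       = true
eqAddr (x ∷ xs) (y ∷ ys) = (x ==ℕ y) ∧ eqAddr xs ys
eqAddr _        _        = false

memℕ : ℕ → List ℕ → Bool
memℕ i []       = false
memℕ i (j ∷ js) = (i ==ℕ j) ∨ memℕ i js

childOf : Address → Address → Ramification → Bool
childOf []       (i ∷ []) I = memℕ i I
childOf (x ∷ α)  (y ∷ β)  I = (x ==ℕ y) ∧ childOf α β I
childOf _        _        _ = false

justifiesᵇ : Action → Action → Bool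
justifiesᵇ (act π α I) (act π' β _) = not (eqPol π π') ∧ childOf α β I
justifiesᵇ _           _            = false

Justifies : Action → Action → Set
Justifies a κ = T (justifiesᵇ a κ)

initialᵇ : Address → Action → Bool
initialᵇ ξ (act _ α _) = eqAddr ξ α
initialᵇ ξ daimon      = false

Initial : Address → Action → Set
Initial ξ κ = T (initialᵇ ξ κ)

-- Views (computed on reversed sequences: head = last action)

mutual
  viewRev : Address → List Action → List Action
  viewRev ξ []      = []
  viewRev ξ (κ ∷ w) with polarity κ
  ... | pos = κ ∷ viewRev ξ w
  ... | neg = if initialᵇ ξ κ then κ ∷ [] else κ ∷ seek ξ κ w

  -- view of the prefix ending with the justifier of κ
  seek : Address → Action → List Action → List Action
  seek ξ κ []      = []
  seek ξ κ (a ∷ w) = if justifiesᵇ a κ then viewRev ξ (a ∷ w) else seek ξ κ w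

view : Address → List Action → List Action
view ξ w = reverse (viewRev ξ (reverse w))

Prefix : List Action → List Action → Set
Prefix w p = ∃ λ r → w ++ r ≡ p

record Path (ξ : Address) (p : List Action) : Set where
  field
    startsPositive : ∃ λ κ → ∃ λ r → p ≡ κ ∷ r × polarity κ ≡ pos
    alternating    : ∀ w a b r → p ≡ w ++ a ∷ b ∷ r → polarity a ≢ polarity b
    justified      : ∀ w κ r → p ≡ w ++ κ ∷ r → Proper κ →
                     Initial ξ κ ⊎ (∃ λ a → a ∈ w × Justifies a κ)
    viewJustified  : ∀ w κ r → p ≡ w ++ κ ∷ r → polarity κ ≡ pos →
                     ∀ a → a ∈ w → Justifies a κ → a ∈ view ξ w
    distinctAddr   : Unique (mapMaybe address p)
    daimonLast     : ∀ w r → p ≡ w ++ daimon ∷ r → r ≡ []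

-- Designs as sets of chronicles

Design : Set₁
Design = List Action → Set

PathOf : Address → Design → List Action → Set
PathOf ξ 𝔇 p = Path ξ p × (∀ w → w ≢ [] → Prefix w p → 𝔇 (view ξ w))

ActionOf : Design → Action → Set
ActionOf 𝔇 κ = ∃ λ c → 𝔇 c × κ ∈ c

PrefixClosure : Design → Design
PrefixClosure S c = c ≢ [] × ∃ λ d → S d × Prefix c d

nat : ℕ → Address → Design
nat zero    τ c = c ≡ [ act pos τ [] ]
nat (suc k) τ = PrefixClosure λ c →
  ∃ λ d → nat k (τ ∷ʳ 0 ∷ʳ 1) d ×
          c ≡ act pos τ (0 ∷ []) ∷ act neg (τ ∷ʳ 0) (1 ∷ []) ∷ d

list : ∀ {n} → Vec ℕ n → Address → Design
list []ᵥ        ξ c = c ≡ [ act pos ξ [] ]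
list (a ∷ᵥ as) ξ = PrefixClosure λ c →
  (∃ λ d → nat a (ξ ∷ʳ 0 ∷ʳ 1) d ×
           c ≡ act pos ξ (0 ∷ 1 ∷ []) ∷ act neg (ξ ∷ʳ 0) (1 ∷ []) ∷ d)
  ⊎
  (∃ λ d → list as (ξ ∷ʳ 1 ∷ʳ 1) d ×
           c ≡ act pos ξ (0 ∷ 1 ∷ []) ∷ act neg (ξ ∷ʳ 1) (1 ∷ []) ∷ d)

-- 𝕃ₙ = { list as ξ | as : Vec ℕ n }; quantifying over 𝔈 ∈ 𝕃ₙ is quantifying over as.

module Submission where

-- Besides its first action (+,ζ,{0,1}), the design 𝔇^{a ∷ as}_ζ has two
-- branches: (-,ζ.0,{1}) followed by the maximal chronicle of (𝐚)_{ζ.0.1}, and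
-- (-,ζ.1,{1}) followed by 𝔇^{as}_{ζ.1.1}.  The path `listPath as ζ` plays the
-- first branch to its end, then jumps back to ζ.1 and continues recursively; it
-- visibly contains every action of the design (`listPath-complete`).  That it is
-- a path of the design rests on three invariants proved along the construction:
--   * legality (`Legal`): each action opens, answers the action just before
--     it, or is a negative one justified earlier (`legal-path`);
--   * locality: all actions lie in the subtree of the root, at pairwise
--     distinct addresses (`listPath-inTree`, `listPath-distinct`);
--   * views: a segment all of whose actions are justified inside it contributes
--     its own view (`view-++`), and a negative action forgets everything played
--     since its justifier (`view-negative`); hence the view of every prefix of
--     the path is a prefix of one of the two branches (`listPath-chronicle`).

open import Defs
open import Data.Nat using (ℕ; zero; suc; _<_; _≤_; s≤s; z≤n)
open import Data.Nat.Properties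
  using (≡⇒≡ᵇ; ≡ᵇ⇒≡; m≤m+n; m<m+n; <-≤-trans; ≤-<-trans; ≤-trans; ≤-reflexive; <-irrefl)
open import Data.Bool using (true; false; T)
open import Data.Bool.Properties using (T-∧)
open import Data.List using (List; []; _∷_; _++_; _∷ʳ_; [_]; reverse; mapMaybe; length)
open import Data.List.Properties
  using (++-assoc; ++-identityʳ; ++-cancelˡ; ++-conicalʳ; ∷-injective; ∷-injectiveˡ;
         ∷ʳ-injectiveˡ; ∷ʳ-injectiveʳ; ∷ʳ-++; reverse-++; unfold-reverse; length-++; mapMaybe-++)
open import Data.List.Membership.Propositional using (_∈_)
open import Data.List.Membership.Propositional.Properties using (∈-++⁺ˡ; ∈-++⁺ʳ; ∈-++⁻)
open import Data.List.Relation.Unary.Any as Any using (Any; here; there)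
open import Data.List.Relation.Unary.Any.Properties using ()
  renaming (reverse⁺ to Any-reverse⁺; reverse⁻ to Any-reverse⁻)
open import Data.List.Relation.Unary.All as All using (All; []; _∷_)
open import Data.List.Relation.Unary.All.Properties using () renaming (++⁺ to All-++⁺; ++⁻ˡ to All-++⁻ˡ)
open import Data.List.Relation.Unary.AllPairs using ([]; _∷_)
open import Data.List.Relation.Unary.Unique.Propositional using (Unique)
open import Data.List.Relation.Unary.Unique.Propositional.Properties using () renaming (++⁺ to Unique-++⁺)
open import Data.Maybe using (just)
open import Data.Vec using (Vec) renaming ([] to []ᵥ; _∷_ to _∷ᵥ_)
open import Data.Product using (∃; ∃₂; _×_; _,_; proj₂)
open import Data.Sum using (_⊎_; inj₁; inj₂)
open import Data.Empty using (⊥; ⊥-elim)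
open import Function.Bundles using (Equivalence)
open import Relation.Nullary using (¬_)
open import Relation.Binary.PropositionalEquality
  using (_≡_; _≢_; refl; sym; trans; cong; cong₂; subst; module ≡-Reasoning)

eqAddr-refl : ∀ α → T (eqAddr α α)
eqAddr-refl []      = _
eqAddr-refl (x ∷ α) = Equivalence.from T-∧ (≡⇒≡ᵇ x x refl , eqAddr-refl α)

eqAddr-sound : ∀ α β → T (eqAddr α β) → α ≡ β
eqAddr-sound []      []      _ = refl
eqAddr-sound (x ∷ α) (y ∷ β) t with Equivalence.to T-∧ t
... | x=y , α=β = cong₂ _∷_ (≡ᵇ⇒≡ x y x=y) (eqAddr-sound α β α=β)
eqAddr-sound []      (_ ∷ _) ()
eqAddr-sound (_ ∷ _) []      ()

childOf-snoc : ∀ α {i I} → T (memℕ i I) → T (childOf α (α ∷ʳ i) I)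
childOf-snoc []      i∈I = i∈I
childOf-snoc (x ∷ α) i∈I = Equivalence.from T-∧ (≡⇒≡ᵇ x x refl , childOf-snoc α i∈I)

childOf-sound : ∀ α β {I} → T (childOf α β I) → ∃ λ i → β ≡ α ∷ʳ i
childOf-sound []      (i ∷ [])    _ = i , refl
childOf-sound (x ∷ α) (y ∷ β)     t with Equivalence.to T-∧ t
... | x=y , child with refl ← ≡ᵇ⇒≡ x y x=y with childOf-sound α β child
...   | i , refl = i , refl
childOf-sound []      []          ()
childOf-sound []      (_ ∷ _ ∷ _) ()
childOf-sound (_ ∷ _) []          ()

opposite : Pol → Pol
opposite pos = neg
opposite neg = pos

justifies-child : ∀ π α I i K → T (memℕ i I) →
                  Justifies (act π α I) (act (opposite π) (α ∷ʳ i) K)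
justifies-child pos α I i K i∈I = childOf-snoc α i∈I
justifies-child neg α I i K i∈I = childOf-snoc α i∈I

justified-address : ∀ π α I π′ β K → Justifies (act π α I) (act π′ β K) →
                    ∃ λ i → β ≡ α ∷ʳ i
justified-address π α I π′ β K j = childOf-sound α β (proj₂ (Equivalence.to T-∧ j))

justified-polarity : ∀ a κ → Justifies a κ → polarity a ≢ polarity κ
justified-polarity (act pos _ _) (act pos _ _) () refl
justified-polarity (act neg _ _) (act neg _ _) () refl

justifiers-address : ∀ a b κ → Justifies a κ → Justifies b κ →
                     ∃ λ α → address a ≡ just α × address b ≡ just α
justifiers-address (act π α I) (act π′ α′ I′) (act π″ β K) ja jb
  with i , e ← justified-address π α I π″ β K ja | j , e′ ← justified-address π′ α′ I′ π″ β K jb =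
  α , refl , cong just (sym (∷ʳ-injectiveˡ α α′ (trans (sym e) e′)))

infix 4 _≼_

_≼_ : Address → Address → Set
τ ≼ α = ∃ λ s → α ≡ τ ++ s

≼-refl : ∀ τ → τ ≼ τ
≼-refl τ = [] , sym (++-identityʳ τ)

≼-trans : ∀ {τ σ α} → τ ≼ σ → σ ≼ α → τ ≼ α
≼-trans {τ} (s , refl) (t , refl) = s ++ t , ++-assoc τ s t

≼-child : ∀ τ i → τ ≼ τ ∷ʳ i
≼-child τ i = [ i ] , refl

≼-grandchild : ∀ τ i j → τ ≼ τ ∷ʳ i ∷ʳ j
≼-grandchild τ i j = ≼-trans (≼-child τ i) (≼-child _ j)

≼-length : ∀ {τ α} → τ ≼ α → length τ ≤ length α
≼-length {τ} (s , refl) = ≤-trans (m≤m+n (length τ) (length s)) (≤-reflexive (sym (length-++ τ)))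

descendant-length : ∀ {τ α} i → τ ∷ʳ i ≼ α → length τ < length α
descendant-length {τ} i le =
  <-≤-trans (m<m+n (length τ) (s≤s z≤n)) (≤-trans (≤-reflexive (sym (length-++ τ))) (≼-length le))

descendant-≢ : ∀ {τ α} i → τ ∷ʳ i ≼ α → τ ≢ α
descendant-≢ i le refl = <-irrefl refl (descendant-length i le)

branches-disjoint : ∀ τ {α} → τ ∷ʳ 0 ≼ α → τ ∷ʳ 1 ≼ α → ⊥
branches-disjoint τ (s , refl) (t , e)
  with () ← ∷-injectiveˡ (++-cancelˡ τ (0 ∷ s) (1 ∷ t)
                           (trans (sym (∷ʳ-++ τ 0 s)) (trans e (∷ʳ-++ τ 1 t))))

InTree : Address → Action → Set
InTree τ (act _ α _) = τ ≼ α
InTree τ daimon      = ⊥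

inTree-weaken : ∀ {τ σ} → τ ≼ σ → ∀ {κ} → InTree σ κ → InTree τ κ
inTree-weaken τ≼σ {act _ _ _} σ≼α = ≼-trans τ≼σ σ≼α

justified-not-initial : ∀ ξ a κ → InTree ξ a → Justifies a κ → initialᵇ ξ κ ≡ false
justified-not-initial ξ (act π α I) (act π′ β K) ξ≼α j with i , refl ← justified-address π α I π′ β K j
  with eqAddr ξ (α ∷ʳ i) in eq
... | false = refl
... | true  = ⊥-elim (<-irrefl (cong length (eqAddr-sound ξ (α ∷ʳ i) (subst T (sym eq) _)))
                               (≤-<-trans (≼-length ξ≼α) (descendant-length i (≼-refl (α ∷ʳ i)))))

left-cannot-justify : ∀ ζ a π K → InTree (ζ ∷ʳ 0) a → ¬ Justifies a (act π (ζ ∷ʳ 1) K)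
left-cannot-justify ζ (act π′ α I) π K ζ0≼α j with i , e ← justified-address π′ α I π (ζ ∷ʳ 1) K j =
  descendant-≢ 0 ζ0≼α (∷ʳ-injectiveˡ ζ α e)

down : Address → ℕ → Action
down τ i = act neg (τ ∷ʳ i) (1 ∷ [])

justifies-down : ∀ τ I i → T (memℕ i I) → Justifies (act pos τ I) (down τ i)
justifies-down τ I i = justifies-child pos τ I i (1 ∷ [])

down-justifies : ∀ τ i K → Justifies (down τ i) (act pos (τ ∷ʳ i ∷ʳ 1) K)
down-justifies τ i K = justifies-child neg (τ ∷ʳ i) (1 ∷ []) 1 K _

-- The maximal chronicle (+,τ,{0})(-,τ.0,{1})(+,τ.0.1,{0})⋯(+,τ.(0.1)ᵏ,∅) of 𝐤_τ.
natPath : ℕ → Address → List Action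
natPath zero    τ = act pos τ [] ∷ []
natPath (suc k) τ = act pos τ (0 ∷ []) ∷ down τ 0 ∷ natPath k (τ ∷ʳ 0 ∷ʳ 1)

listPath : ∀ {n} → Vec ℕ n → Address → List Action
listPath []ᵥ       ζ = act pos ζ [] ∷ []
listPath (a ∷ᵥ as) ζ = act pos ζ (0 ∷ 1 ∷ []) ∷ down ζ 0 ∷
  (natPath a (ζ ∷ʳ 0 ∷ʳ 1) ++ down ζ 1 ∷ listPath as (ζ ∷ʳ 1 ∷ʳ 1))

listPath-head : ∀ {n} (as : Vec ℕ n) ζ → ∃₂ λ I r → listPath as ζ ≡ act pos ζ I ∷ r
listPath-head []ᵥ       ζ = _ , _ , refl
listPath-head (a ∷ᵥ as) ζ = _ , _ , refl

natPath-last : ∀ k τ → ∃₂ λ u b → natPath k τ ≡ u ∷ʳ b × polarity b ≡ pos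
natPath-last zero    τ = [] , _ , refl , refl
natPath-last (suc k) τ with u , b , e , pb ← natPath-last k (τ ∷ʳ 0 ∷ʳ 1) =
  _ ∷ _ ∷ u , b , cong (λ z → _ ∷ _ ∷ z) e , pb

natPath-complete : ∀ {κ} k τ c → nat k τ c → κ ∈ c → κ ∈ natPath k τ
natPath-complete zero    τ c refl κ∈c = κ∈c
natPath-complete (suc k) τ c (_ , _ , (d , d∈ , refl) , r , e) κ∈c
  with subst (_ ∈_) e (∈-++⁺ˡ κ∈c)
... | here  refl        = here refl
... | there (here refl) = there (here refl)
... | there (there κ∈d) = there (there (natPath-complete k _ d d∈ κ∈d))

listPath-complete : ∀ {κ n} (as : Vec ℕ n) ζ c → list as ζ c → κ ∈ c → κ ∈ listPath as ζ
listPath-complete []ᵥ       ζ c refl κ∈c = κ∈c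
listPath-complete (a ∷ᵥ as) ζ c (_ , _ , inj₁ (d , d∈ , refl) , r , e) κ∈c
  with subst (_ ∈_) e (∈-++⁺ˡ κ∈c)
... | here  refl        = here refl
... | there (here refl) = there (here refl)
... | there (there κ∈d) = there (there (∈-++⁺ˡ (natPath-complete a _ d d∈ κ∈d)))
listPath-complete (a ∷ᵥ as) ζ c (_ , _ , inj₂ (d , d∈ , refl) , r , e) κ∈c
  with subst (_ ∈_) e (∈-++⁺ˡ κ∈c)
... | here  refl        = here refl
... | there (here refl) = there (there (∈-++⁺ʳ (natPath a _) (here refl)))
... | there (there κ∈d) =
  there (there (∈-++⁺ʳ (natPath a _) (there (listPath-complete as _ d d∈ κ∈d))))

natPath-chronicle : ∀ k τ → nat k τ (natPath k τ)
natPath-chronicle zero    τ = refl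
natPath-chronicle (suc k) τ =
  (λ ()) , natPath (suc k) τ , (_ , natPath-chronicle k _ , refl) , [] , ++-identityʳ _

first-branch : ∀ {n} a (as : Vec ℕ n) ζ v d → nat a (ζ ∷ʳ 0 ∷ʳ 1) d → Prefix v d →
               list (a ∷ᵥ as) ζ (act pos ζ (0 ∷ 1 ∷ []) ∷ down ζ 0 ∷ v)
first-branch a as ζ v d d∈ (r , e) =
  (λ ()) , _ , inj₁ (d , d∈ , refl) , r , cong (λ z → _ ∷ _ ∷ z) e

second-branch : ∀ {n} a (as : Vec ℕ n) ζ v d → list as (ζ ∷ʳ 1 ∷ʳ 1) d → Prefix v d →
                list (a ∷ᵥ as) ζ (act pos ζ (0 ∷ 1 ∷ []) ∷ down ζ 1 ∷ v)
second-branch a as ζ v d d∈ (r , e) =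
  (λ ()) , _ , inj₂ (d , d∈ , refl) , r , cong (λ z → _ ∷ _ ∷ z) e

list-opening : ∀ {n} a (as : Vec ℕ n) ζ → list (a ∷ᵥ as) ζ (act pos ζ (0 ∷ 1 ∷ []) ∷ [])
list-opening a as ζ = (λ ()) , _ , inj₁ (_ , natPath-chronicle a _ , refl) , _ , refl

list-inhabited : ∀ {n} (as : Vec ℕ n) ζ → ∃ λ d → list as ζ d
list-inhabited []ᵥ       ζ = _ , refl
list-inhabited (a ∷ᵥ as) ζ = _ , list-opening a as ζ

data Move (u : List Action) (κ : Action) : Set where
  opening  : u ≡ [] → polarity κ ≡ pos → Move u κ
  answer   : ∀ u₀ b → u ≡ u₀ ∷ʳ b → Justifies b κ → Move u κ
  return   : ∀ u₀ b a → u ≡ u₀ ∷ʳ b → polarity b ≡ pos → polarity κ ≡ neg →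
             a ∈ u → Justifies a κ → Move u κ

data Legal : List Action → List Action → Set where
  []  : ∀ {C} → Legal C []
  _∷_ : ∀ {C κ S} → Move C κ → Legal (C ∷ʳ κ) S → Legal C (κ ∷ S)

legal-++ : ∀ {C} S₁ {S₂} → Legal C S₁ → Legal (C ++ S₁) S₂ → Legal C (S₁ ++ S₂)
legal-++ {C} []       {S₂} []       l₂ = subst (λ c → Legal c S₂) (++-identityʳ C) l₂
legal-++ {C} (κ ∷ S₁) {S₂} (m ∷ l₁) l₂ =
  m ∷ legal-++ S₁ l₁ (subst (λ c → Legal c S₂) (sym (∷ʳ-++ C κ S₁)) l₂)

legal-prefix : ∀ {C} w {r} → Legal C (w ++ r) → Legal C w
legal-prefix []      _        = []
legal-prefix (κ ∷ w) (m ∷ l) = m ∷ legal-prefix w l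

legal-at : ∀ {C S} → Legal C S → ∀ w κ r → S ≡ w ++ κ ∷ r → Move (C ++ w) κ
legal-at {C} (m ∷ l) []      κ r refl = subst (λ c → Move c κ) (sym (++-identityʳ C)) m
legal-at {C} (m ∷ l) (y ∷ w) κ r e with refl , e′ ← ∷-injective e =
  subst (λ c → Move c κ) (∷ʳ-++ C y w) (legal-at l w κ r e′)

∈-snoc : ∀ (u : List Action) b → b ∈ u ∷ʳ b
∈-snoc u b = ∈-++⁺ʳ u (here refl)

-- natPath k τ is legal wherever a positive action at τ is: each negative action
-- returns to the positive action just played, which in turn it justifies.
natPath-legal : ∀ k τ C → (∀ K → Move C (act pos τ K)) → Legal C (natPath k τ)
natPath-legal zero    τ C start = start [] ∷ []
natPath-legal (suc k) τ C start =
  start _ ∷ return C p p refl refl refl (∈-snoc C p) (justifies-down τ (0 ∷ []) 0 _)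
          ∷ natPath-legal k (τ ∷ʳ 0 ∷ʳ 1) _
              (λ K → answer (C ∷ʳ p) (down τ 0) refl (down-justifies τ 0 K))
  where p = act pos τ (0 ∷ [])

-- Likewise for listPath, where after the first branch (-,ζ.1,{1}) jumps back
-- to the opening action (+,ζ,{0,1}).
listPath-legal : ∀ {n} (as : Vec ℕ n) ζ C → (∀ K → Move C (act pos ζ K)) → Legal C (listPath as ζ)
listPath-legal []ᵥ       ζ C start = start [] ∷ []
listPath-legal (a ∷ᵥ as) ζ C start =
  start _ ∷ return C p p refl refl refl (∈-snoc C p) (justifies-down ζ (0 ∷ 1 ∷ []) 0 _)
          ∷ legal-++ (natPath a _)
              (natPath-legal a _ C₂ (λ K → answer (C ∷ʳ p) (down ζ 0) refl (down-justifies ζ 0 K)))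
              (jump ∷ listPath-legal as _ _
                 (λ K → answer (C₂ ++ natPath a _) (down ζ 1) refl (down-justifies ζ 1 K)))
  where
  p  = act pos ζ (0 ∷ 1 ∷ [])
  C₂ = C ∷ʳ p ∷ʳ down ζ 0
  jump : Move (C₂ ++ natPath a (ζ ∷ʳ 0 ∷ʳ 1)) (down ζ 1)
  jump with u , b , e , pb ← natPath-last a (ζ ∷ʳ 0 ∷ʳ 1) =
    return (C₂ ++ u) b p (trans (cong (C₂ ++_) e) (sym (++-assoc C₂ u [ b ]))) pb refl
           (∈-++⁺ˡ (∈-++⁺ˡ (∈-snoc C p))) (justifies-down ζ (0 ∷ 1 ∷ []) 1 _)

natPath-inTree : ∀ k τ → All (InTree τ) (natPath k τ)
natPath-inTree zero    τ = ≼-refl τ ∷ []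
natPath-inTree (suc k) τ = ≼-refl τ ∷ ≼-child τ 0 ∷
  All.map (inTree-weaken (≼-grandchild τ 0 1)) (natPath-inTree k _)

listPath-inTree : ∀ {n} (as : Vec ℕ n) ζ → All (InTree ζ) (listPath as ζ)
listPath-inTree []ᵥ       ζ = ≼-refl ζ ∷ []
listPath-inTree (a ∷ᵥ as) ζ = ≼-refl ζ ∷ ≼-child ζ 0 ∷
  All-++⁺ (All.map (inTree-weaken (≼-grandchild ζ 0 1)) (natPath-inTree a _))
          (≼-child ζ 1 ∷ All.map (inTree-weaken (≼-grandchild ζ 1 1)) (listPath-inTree as _))

addresses : List Action → List Address
addresses = mapMaybe address

Distinct : Address → List Address → Set
Distinct τ xs = All (τ ≼_) xs × Unique xs

distinct-root : ∀ τ i {xs} → Distinct (τ ∷ʳ i) xs → Distinct τ (τ ∷ xs)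
distinct-root τ i (below , unique) =
  ≼-refl τ ∷ All.map (≼-trans (≼-child τ i)) below , All.map (descendant-≢ i) below ∷ unique

distinct-fork : ∀ τ {xs ys} → Distinct (τ ∷ʳ 0) xs → Distinct (τ ∷ʳ 1) ys → Distinct τ (τ ∷ xs ++ ys)
distinct-fork τ (below₀ , unique₀) (below₁ , unique₁) =
  ≼-refl τ ∷ All-++⁺ (All.map (≼-trans (≼-child τ 0)) below₀) (All.map (≼-trans (≼-child τ 1)) below₁) ,
  All-++⁺ (All.map (descendant-≢ 0) below₀) (All.map (descendant-≢ 1) below₁) ∷
  Unique-++⁺ unique₀ unique₁ (λ (α∈xs , α∈ys) →
    branches-disjoint τ (All.lookup below₀ α∈xs) (All.lookup below₁ α∈ys))

natPath-distinct : ∀ k τ → Distinct τ (addresses (natPath k τ))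
natPath-distinct zero    τ = ≼-refl τ ∷ [] , [] ∷ []
natPath-distinct (suc k) τ = distinct-root τ 0 (distinct-root (τ ∷ʳ 0) 1 (natPath-distinct k _))

listPath-distinct : ∀ {n} (as : Vec ℕ n) ζ → Distinct ζ (addresses (listPath as ζ))
listPath-distinct []ᵥ       ζ = ≼-refl ζ ∷ [] , [] ∷ []
listPath-distinct (a ∷ᵥ as) ζ =
  subst (λ xs → Distinct ζ (ζ ∷ ζ ∷ʳ 0 ∷ xs)) (sym (mapMaybe-++ address (natPath a _) _))
    (distinct-fork ζ (distinct-root (ζ ∷ʳ 0) 1 (natPath-distinct a _))
                     (distinct-root (ζ ∷ʳ 1) 1 (listPath-distinct as _)))

address-∈ : ∀ S {c α} → c ∈ S → address c ≡ just α → α ∈ addresses S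
address-∈ (act _ _ _ ∷ S) (here refl) refl = here refl
address-∈ (act _ _ _ ∷ S) (there c∈) e    = there (address-∈ S c∈ e)
address-∈ (daimon ∷ S)    (here refl) ()
address-∈ (daimon ∷ S)    (there c∈) e    = address-∈ S c∈ e

earlier-address : ∀ u {b r a α} → Unique (addresses (u ++ b ∷ r)) → address b ≡ just α →
                  a ∈ u → address a ≢ just α
earlier-address (act _ _ _ ∷ u) {b} {r} (β∉ ∷ _) eb (here refl) refl =
  All.lookup β∉ (address-∈ (u ++ b ∷ r) (∈-++⁺ʳ u (here refl)) eb) refl
earlier-address (act _ _ _ ∷ u) (_ ∷ uq) eb (there a∈) = earlier-address u uq eb a∈
earlier-address (daimon ∷ u)    uq       eb (here refl) ()
earlier-address (daimon ∷ u)    uq       eb (there a∈) = earlier-address u uq eb a∈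

reverse-∷ʳ : ∀ (u : List Action) b → reverse (u ∷ʳ b) ≡ b ∷ reverse u
reverse-∷ʳ u b = reverse-++ u [ b ]

module Views (ξ : Address) where

  -- Closed Y, for a segment Y stored most recent action first: every action
  -- of Y is positive, or is non-initial and justified by an earlier action of
  -- Y.  The view of such a segment never looks past its beginning.
  data Closed : List Action → Set where
    []        : Closed []
    positive  : ∀ {κ Y} → polarity κ ≡ pos → Closed Y → Closed (κ ∷ Y)
    justified : ∀ {κ Y} → initialᵇ ξ κ ≡ false → Any (λ a → Justifies a κ) Y →
                Closed Y → Closed (κ ∷ Y)

  mutual
    viewRev-++ : ∀ {Y} S → Closed Y → viewRev ξ (Y ++ S) ≡ viewRev ξ Y ++ viewRev ξ S
    viewRev-++ S []                      = refl
    viewRev-++ S (positive {κ} p c)      rewrite p = cong (κ ∷_) (viewRev-++ S c)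
    viewRev-++ S (justified {κ} ni j c) with polarity κ
    ... | pos                 = cong (κ ∷_) (viewRev-++ S c)
    ... | neg rewrite ni      = cong (κ ∷_) (seek-++ S c j)

    seek-++ : ∀ {Y κ} S → Closed Y → Any (λ a → Justifies a κ) Y →
              seek ξ κ (Y ++ S) ≡ seek ξ κ Y ++ viewRev ξ S
    seek-++ {a ∷ Y} {κ} S c j with justifiesᵇ a κ in eq
    ... | true  = viewRev-++ S c
    seek-++ S c                 (here aJκ)  | false = ⊥-elim (subst T eq aJκ)
    seek-++ S (positive _ c)    (there j′) | false = seek-++ S c j′
    seek-++ S (justified _ _ c) (there j′) | false = seek-++ S c j′

  view-++ : ∀ x y → Closed (reverse y) → view ξ (x ++ y) ≡ view ξ x ++ view ξ y
  view-++ x y c = begin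
    reverse (viewRev ξ (reverse (x ++ y)))
      ≡⟨ cong (λ z → reverse (viewRev ξ z)) (reverse-++ x y) ⟩
    reverse (viewRev ξ (reverse y ++ reverse x))
      ≡⟨ cong reverse (viewRev-++ (reverse x) c) ⟩
    reverse (viewRev ξ (reverse y) ++ viewRev ξ (reverse x))
      ≡⟨ reverse-++ (viewRev ξ (reverse y)) _ ⟩
    view ξ x ++ view ξ y ∎
    where open ≡-Reasoning

  closed-snoc : ∀ {C κ} → All (InTree ξ) C → Closed (reverse C) → Move C κ → Closed (reverse (C ∷ʳ κ))
  closed-snoc {C} {κ} inC c m = subst Closed (sym (reverse-∷ʳ C κ)) (extend m)
    where
    extend : Move C κ → Closed (κ ∷ reverse C)
    extend (opening _ p) = positive p c
    extend (answer u₀ b refl j) =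
      justified (justified-not-initial ξ b κ (All.lookup inC (∈-snoc u₀ b)) j)
                (Any-reverse⁺ (Any.map (λ { refl → j }) (∈-snoc u₀ b))) c
    extend (return _ _ a _ _ _ a∈ j) =
      justified (justified-not-initial ξ a κ (All.lookup inC a∈) j)
                (Any-reverse⁺ (Any.map (λ { refl → j }) a∈)) c

  legal-closed : ∀ {C} S → All (InTree ξ) C → All (InTree ξ) S → Closed (reverse C) → Legal C S →
                 Closed (reverse (C ++ S))
  legal-closed {C} []      _   _           c []      = subst Closed (cong reverse (sym (++-identityʳ C))) c
  legal-closed {C} (κ ∷ S) inC (κin ∷ inS) c (m ∷ l) =
    subst (λ z → Closed (reverse z)) (∷ʳ-++ C κ S)
      (legal-closed S (All-++⁺ inC (κin ∷ [])) inS (closed-snoc inC c m) l)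

  prefix-closed : ∀ {S w} → All (InTree ξ) S → Legal [] S → Prefix w S → Closed (reverse w)
  prefix-closed {w = w} inS l (r , refl) =
    legal-closed w [] (All-++⁻ˡ w inS) [] (legal-prefix w l)

  view-negative : ∀ u a v β K → initialᵇ ξ (act neg β K) ≡ false → Justifies a (act neg β K) →
                  All (λ b → ¬ Justifies b (act neg β K)) v →
                  view ξ ((u ++ a ∷ v) ∷ʳ act neg β K) ≡ view ξ (u ∷ʳ a) ∷ʳ act neg β K
  view-negative u a v β K ni j skip = begin
    reverse (viewRev ξ (reverse ((u ++ a ∷ v) ∷ʳ κ)))
      ≡⟨ cong (λ z → reverse (viewRev ξ z)) (reverse-∷ʳ (u ++ a ∷ v) κ) ⟩
    reverse (viewRev ξ (κ ∷ reverse (u ++ a ∷ v)))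
      ≡⟨ cong reverse (viewRev-κ (reverse (u ++ a ∷ v))) ⟩
    reverse (κ ∷ seek′ (reverse (u ++ a ∷ v)))
      ≡⟨ cong (λ z → reverse (κ ∷ seek′ z)) (reverse-split u a v) ⟩
    reverse (κ ∷ seek′ (reverse v ++ a ∷ reverse u))
      ≡⟨ cong (λ z → reverse (κ ∷ z)) (seek-skip (reverse v) skip-reversed) ⟩
    reverse (κ ∷ seek′ (a ∷ reverse u))
      ≡⟨ cong (λ z → reverse (κ ∷ z)) seek-found ⟩
    reverse (κ ∷ viewRev ξ (a ∷ reverse u))
      ≡⟨ unfold-reverse κ (viewRev ξ (a ∷ reverse u)) ⟩
    reverse (viewRev ξ (a ∷ reverse u)) ∷ʳ κ
      ≡⟨ cong (λ z → reverse (viewRev ξ z) ∷ʳ κ) (sym (reverse-∷ʳ u a)) ⟩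
    view ξ (u ∷ʳ a) ∷ʳ κ ∎
    where
    open ≡-Reasoning
    κ = act neg β K
    seek′ : List Action → List Action
    seek′ = seek ξ κ
    viewRev-κ : ∀ R → viewRev ξ (κ ∷ R) ≡ κ ∷ seek′ R
    viewRev-κ R rewrite ni = refl
    reverse-split : ∀ u a v → reverse (u ++ a ∷ v) ≡ reverse v ++ a ∷ reverse u
    reverse-split u a v = trans (reverse-++ u (a ∷ v))
      (trans (cong (_++ reverse u) (unfold-reverse a v)) (∷ʳ-++ (reverse v) a (reverse u)))
    skip-reversed : All (λ b → ¬ Justifies b κ) (reverse v)
    skip-reversed = All.tabulate (λ b∈ → All.lookup skip (Any-reverse⁻ b∈))
    seek-skip : ∀ Y {R} → All (λ b → ¬ Justifies b κ) Y → seek′ (Y ++ R) ≡ seek′ R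
    seek-skip []      []        = refl
    seek-skip (b ∷ Y) (¬j ∷ ¬js) with justifiesᵇ b κ
    ... | true  = ⊥-elim (¬j _)
    ... | false = seek-skip Y ¬js
    seek-found : seek′ (a ∷ reverse u) ≡ viewRev ξ (a ∷ reverse u)
    seek-found with justifiesᵇ a κ
    ... | true  = refl
    ... | false = ⊥-elim j

  viewRev-head : ∀ b R → ∃ λ t → viewRev ξ (b ∷ R) ≡ b ∷ t
  viewRev-head b R with polarity b
  ... | pos = _ , refl
  ... | neg with initialᵇ ξ b
  ...   | true  = _ , refl
  ...   | false = _ , refl

  view-last : ∀ u b → b ∈ view ξ (u ∷ʳ b)
  view-last u b with t , e ← viewRev-head b (reverse u) =
    subst (b ∈_) (sym view≡) (∈-snoc (reverse t) b)
    where
    open ≡-Reasoning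
    view≡ : view ξ (u ∷ʳ b) ≡ reverse t ∷ʳ b
    view≡ = begin
      reverse (viewRev ξ (reverse (u ∷ʳ b))) ≡⟨ cong (λ z → reverse (viewRev ξ z)) (reverse-∷ʳ u b) ⟩
      reverse (viewRev ξ (b ∷ reverse u))    ≡⟨ cong reverse e ⟩
      reverse (b ∷ t)                        ≡⟨ unfold-reverse b t ⟩
      reverse t ∷ʳ b                         ∎

  view-pair : ∀ τ I i v → T (memℕ i I) → ξ ≼ τ → Closed (reverse v) →
              view ξ (act pos τ I ∷ down τ i ∷ v) ≡ act pos τ I ∷ down τ i ∷ view ξ v
  view-pair τ I i v i∈I ξ≼τ c = begin
    view ξ ((p ∷ down τ i ∷ []) ++ v)      ≡⟨ view-++ (p ∷ down τ i ∷ []) v c ⟩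
    view ξ (p ∷ down τ i ∷ []) ++ view ξ v
      ≡⟨ cong (_++ view ξ v) (view-negative [] p [] (τ ∷ʳ i) (1 ∷ [])
            (justified-not-initial ξ p (down τ i) ξ≼τ j) j []) ⟩
    p ∷ down τ i ∷ view ξ v                ∎
    where
    open ≡-Reasoning
    p = act pos τ I
    j = justifies-down τ I i i∈I

  view-return : ∀ τ S v → All (InTree (τ ∷ʳ 0)) S → ξ ≼ τ → Closed (reverse v) →
                view ξ (act pos τ (0 ∷ 1 ∷ []) ∷ down τ 0 ∷ (S ++ down τ 1 ∷ v))
                  ≡ act pos τ (0 ∷ 1 ∷ []) ∷ down τ 1 ∷ view ξ v
  view-return τ S v S-left ξ≼τ c = begin
    view ξ (p ∷ down τ 0 ∷ (S ++ down τ 1 ∷ v))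
      ≡⟨ cong (λ z → view ξ (p ∷ down τ 0 ∷ z)) (sym (∷ʳ-++ S (down τ 1) v)) ⟩
    view ξ (((p ∷ down τ 0 ∷ S) ∷ʳ down τ 1) ++ v)
      ≡⟨ view-++ ((p ∷ down τ 0 ∷ S) ∷ʳ down τ 1) v c ⟩
    view ξ ((p ∷ down τ 0 ∷ S) ∷ʳ down τ 1) ++ view ξ v
      ≡⟨ cong (_++ view ξ v) (view-negative [] p (down τ 0 ∷ S) (τ ∷ʳ 1) (1 ∷ [])
            (justified-not-initial ξ p (down τ 1) ξ≼τ j) j
            (All.map (λ {a} → left-cannot-justify τ a neg (1 ∷ [])) (≼-refl (τ ∷ʳ 0) ∷ S-left))) ⟩
    p ∷ down τ 1 ∷ view ξ v ∎
    where
    open ≡-Reasoning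
    p = act pos τ (0 ∷ 1 ∷ [])
    j = justifies-down τ (0 ∷ 1 ∷ []) 1 _

prefix-∷ : ∀ {w : List Action} {x S} → Prefix w (x ∷ S) → w ≡ [] ⊎ ∃ λ w′ → w ≡ x ∷ w′ × Prefix w′ S
prefix-∷ {[]}     _        = inj₁ refl
prefix-∷ {y ∷ w′} (r , refl) = inj₂ (w′ , refl , r , refl)

prefix-[] : ∀ {w : List Action} → Prefix w [] → w ≡ []
prefix-[] {[]} _ = refl

prefix-++ : ∀ {w : List Action} S₁ {S₂} → Prefix w (S₁ ++ S₂) →
            Prefix w S₁ ⊎ ∃ λ v → w ≡ S₁ ++ v × Prefix v S₂
prefix-++ []       pf = inj₂ (_ , refl , pf)
prefix-++ {[]}    (x ∷ S₁) _       = inj₁ (x ∷ S₁ , refl)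
prefix-++ {y ∷ w} (x ∷ S₁) (r , e) with refl , e′ ← ∷-injective e with prefix-++ S₁ (r , e′)
... | inj₁ (r′ , e″)      = inj₁ (r′ , cong (x ∷_) e″)
... | inj₂ (v , refl , pf) = inj₂ (v , refl , pf)

module Chronicles (ξ : Address) where
  open Views ξ

  natPath-closed : ∀ k τ → ξ ≼ τ → ∀ {w} → Prefix w (natPath k τ) → Closed (reverse w)
  natPath-closed k τ ξ≼τ =
    prefix-closed (All.map (inTree-weaken ξ≼τ) (natPath-inTree k τ))
                  (natPath-legal k τ [] (λ K → opening refl refl))

  listPath-closed : ∀ {n} (as : Vec ℕ n) ζ → ξ ≼ ζ → ∀ {w} → Prefix w (listPath as ζ) → Closed (reverse w)
  listPath-closed as ζ ξ≼ζ =
    prefix-closed (All.map (inTree-weaken ξ≼ζ) (listPath-inTree as ζ))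
                  (listPath-legal as ζ [] (λ K → opening refl refl))

  natPath-view : ∀ k τ → ξ ≼ τ → ∀ w → Prefix w (natPath k τ) → view ξ w ≡ w
  natPath-view zero τ _ w pf with prefix-∷ pf
  ... | inj₁ refl               = refl
  ... | inj₂ (w′ , refl , pf′) with refl ← prefix-[] pf′ = refl
  natPath-view (suc k) τ ξ≼τ w pf with prefix-∷ pf
  ... | inj₁ refl = refl
  ... | inj₂ (w′ , refl , pf′) with prefix-∷ pf′
  ...   | inj₁ refl             = refl
  ...   | inj₂ (v , refl , pfv) =
    trans (view-pair τ (0 ∷ []) 0 v _ ξ≼τ (natPath-closed k _ ξ≼τ′ pfv))
          (cong (λ z → _ ∷ _ ∷ z) (natPath-view k _ ξ≼τ′ v pfv))
    where ξ≼τ′ = ≼-trans ξ≼τ (≼-grandchild τ 0 1)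

  first-branch-view : ∀ {n} a (as : Vec ℕ n) ζ → ξ ≼ ζ → ∀ v → Prefix v (natPath a (ζ ∷ʳ 0 ∷ʳ 1)) →
                      list (a ∷ᵥ as) ζ (view ξ (act pos ζ (0 ∷ 1 ∷ []) ∷ down ζ 0 ∷ v))
  first-branch-view a as ζ ξ≼ζ v pfv =
    subst (list (a ∷ᵥ as) ζ)
      (sym (trans (view-pair ζ _ 0 v _ ξ≼ζ (natPath-closed a _ ξ≼ζ′ pfv))
                  (cong (λ z → _ ∷ _ ∷ z) (natPath-view a _ ξ≼ζ′ v pfv))))
      (first-branch a as ζ v _ (natPath-chronicle a _) pfv)
    where ξ≼ζ′ = ≼-trans ξ≼ζ (≼-grandchild ζ 0 1)

  second-branch-view : ∀ {n} a (as : Vec ℕ n) ζ → ξ ≼ ζ →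
    (∀ w → w ≢ [] → Prefix w (listPath as (ζ ∷ʳ 1 ∷ʳ 1)) → list as (ζ ∷ʳ 1 ∷ʳ 1) (view ξ w)) →
    ∀ v → Prefix v (listPath as (ζ ∷ʳ 1 ∷ʳ 1)) →
    list (a ∷ᵥ as) ζ (view ξ (act pos ζ (0 ∷ 1 ∷ []) ∷ down ζ 0 ∷ (natPath a (ζ ∷ʳ 0 ∷ʳ 1) ++ down ζ 1 ∷ v)))
  second-branch-view a as ζ ξ≼ζ rest v pfv =
    subst (list (a ∷ᵥ as) ζ)
      (sym (view-return ζ (natPath a _) v
              (All.map (inTree-weaken (≼-child (ζ ∷ʳ 0) 1)) (natPath-inTree a _))
              ξ≼ζ (listPath-closed as _ (≼-trans ξ≼ζ (≼-grandchild ζ 1 1)) pfv)))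
      (continue v pfv)
    where
    continue : ∀ v → Prefix v (listPath as (ζ ∷ʳ 1 ∷ʳ 1)) →
               list (a ∷ᵥ as) ζ (act pos ζ (0 ∷ 1 ∷ []) ∷ down ζ 1 ∷ view ξ v)
    continue []      _  = second-branch a as ζ [] _ (proj₂ (list-inhabited as _)) (_ , refl)
    continue (x ∷ v) pf = second-branch a as ζ _ _ (rest (x ∷ v) (λ ()) pf) ([] , ++-identityʳ _)

  listPath-chronicle : ∀ {n} (as : Vec ℕ n) ζ → ξ ≼ ζ →
                       ∀ w → w ≢ [] → Prefix w (listPath as ζ) → list as ζ (view ξ w)
  listPath-chronicle []ᵥ ζ _ w w≢[] pf with prefix-∷ pf
  ... | inj₁ refl               = ⊥-elim (w≢[] refl)
  ... | inj₂ (w′ , refl , pf′) with refl ← prefix-[] pf′ = refl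
  listPath-chronicle (a ∷ᵥ as) ζ ξ≼ζ w w≢[] pf with prefix-∷ pf
  ... | inj₁ refl = ⊥-elim (w≢[] refl)
  ... | inj₂ (w₁ , refl , pf₁) with prefix-∷ pf₁
  ...   | inj₁ refl = list-opening a as ζ
  ...   | inj₂ (w₂ , refl , pf₂) with prefix-++ (natPath a (ζ ∷ʳ 0 ∷ʳ 1)) pf₂
  ...     | inj₁ pfN = first-branch-view a as ζ ξ≼ζ w₂ pfN
  ...     | inj₂ (w₃ , refl , pf₃) with prefix-∷ pf₃
  ...       | inj₁ refl = first-branch-view a as ζ ξ≼ζ _ ([] , trans (++-identityʳ _) (++-identityʳ _))
  ...       | inj₂ (v , refl , pfv) =
    second-branch-view a as ζ ξ≼ζ (listPath-chronicle as _ (≼-trans ξ≼ζ (≼-grandchild ζ 1 1))) v pfv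

legal-path : ∀ ξ p → (∃₂ λ I r → p ≡ act pos ξ I ∷ r) → Legal [] p → All (InTree ξ) p →
             Unique (addresses p) → Path ξ p
legal-path ξ p (I , r₀ , p≡) legal inTree distinct = record
  { startsPositive = act pos ξ I , r₀ , p≡ , refl
  ; alternating    = alternating
  ; justified      = justified
  ; viewJustified  = viewJustified
  ; distinctAddr   = distinct
  ; daimonLast     = λ w r e →
      ⊥-elim (All.lookup inTree (subst (daimon ∈_) (sym e) (∈-++⁺ʳ w (here refl))))
  }
  where
  open Views ξ using (view-last)

  alternating : ∀ w a b r → p ≡ w ++ a ∷ b ∷ r → polarity a ≢ polarity b
  alternating w a b r e with legal-at legal (w ∷ʳ a) b r (trans e (sym (∷ʳ-++ w a (b ∷ r))))
  ... | opening w∷ʳa≡[] _ with () ← ++-conicalʳ w [ a ] w∷ʳa≡[]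
  ... | answer u₀ b′ e′ j rewrite ∷ʳ-injectiveʳ w u₀ e′ = justified-polarity b′ b j
  ... | return u₀ b′ _ e′ pb′ pb _ _ rewrite ∷ʳ-injectiveʳ w u₀ e′ | pb′ | pb = λ ()

  justified : ∀ w κ r → p ≡ w ++ κ ∷ r → Proper κ → Initial ξ κ ⊎ ∃ λ a → a ∈ w × Justifies a κ
  justified w κ r e _ with legal-at legal w κ r e
  ... | opening refl _ with refl ← ∷-injectiveˡ (trans (sym e) p≡) = inj₁ (eqAddr-refl ξ)
  ... | answer u₀ b refl j         = inj₂ (b , ∈-snoc u₀ b , j)
  ... | return _ _ a _ _ _ a∈ j    = inj₂ (a , a∈ , j)

  -- A positive action is justified by the action just before it, which is in
  -- the view; any other justifier would share its address.
  viewJustified : ∀ w κ r → p ≡ w ++ κ ∷ r → polarity κ ≡ pos →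
                  ∀ a → a ∈ w → Justifies a κ → a ∈ view ξ w
  viewJustified w κ r e pκ a a∈w ja with legal-at legal w κ r e
  ... | opening refl _ with () ← a∈w
  ... | return _ _ _ _ _ nκ _ _ with () ← trans (sym pκ) nκ
  ... | answer u₀ b refl jb with ∈-++⁻ u₀ a∈w
  ...   | inj₂ (here refl) = view-last u₀ b
  ...   | inj₁ a∈u₀ with α , ea , eb ← justifiers-address a b κ ja jb =
    ⊥-elim (earlier-address u₀ distinct′ eb a∈u₀ ea)
    where
    distinct′ : Unique (addresses (u₀ ++ b ∷ κ ∷ r))
    distinct′ = subst (λ q → Unique (addresses q)) (trans e (++-assoc u₀ [ b ] (κ ∷ r))) distinct

mainTheorem18 : (ξ : Address) (n : ℕ) (as : Vec ℕ n) →
    ∃ λ p → PathOf ξ (list as ξ) p × (∀ κ → ActionOf (list as ξ) κ → κ ∈ p)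
mainTheorem18 ξ n as =
  listPath as ξ ,
  (legal-path ξ (listPath as ξ) (listPath-head as ξ)
     (listPath-legal as ξ [] (λ K → opening refl refl))
     (listPath-inTree as ξ) (proj₂ (listPath-distinct as ξ)) ,
   listPath-chronicle as ξ (≼-refl ξ)) ,
  λ κ (c , c∈ , κ∈c) → listPath-complete as ξ c c∈ κ∈c
  where open Chronicles ξ
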